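{- Let $H$ be a connected unicyclic graph. Then there exists a tree $T$ on the same vertex set as $H$ such that $\Delta(T) \le \Delta(H)$ and $H \subseteq T^2$.
   Context: A graph is unicyclic if it contains at most one cycle. $\Delta(\cdot)$ denotes maximum degree. For a graph $T$, its square $T^2$ is the graph on $V(T)$ in which two distinct vertices are adjacent iff their distance in $T$ is at most $2$. -}

module Defs where

open import Data.Nat using (ℕ; zero; suc; _+_; _⊔_; _≤_)
open import Data.Nat.DivMod using (_mod_)
open import Data.Fin using (Fin; toℕ)
open import Data.Bool using (Bool; true; false)
open import Data.List using (List; foldr; filter; length; map)
open import Data.List.Base using (allFin)
open import Data.Product using (Σ; ∃; _×_; _,_)
open import Data.Sum using (_⊎_)
open import Data.Empty using (⊥)
open import Relation.Binary.PropositionalEquality using (_≡_; _≢_)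
open import Function.Definitions using (Injective)

record Graph (n : ℕ) : Set where
  field
    adj    : Fin n → Fin n → Bool
    sym    : ∀ u v → adj u v ≡ adj v u
    irrefl : ∀ u → adj u u ≡ false
open Graph public

Edge : ∀ {n} → Graph n → Fin n → Fin n → Set
Edge G u v = adj G u v ≡ true

degree : ∀ {n} → Graph n → Fin n → ℕ
degree {n} G u = length (filter (λ v → Data.Bool._≟_ (adj G u v) true) (allFin n))

Δ : ∀ {n} → Graph n → ℕ
Δ {n} G = foldr _⊔_ 0 (map (degree G) (allFin n))

data Walk {n} (G : Graph n) : Fin n → Fin n → Set where
  here : ∀ {u} → Walk G u u
  step : ∀ {u v w} → Edge G u v → Walk G v w → Walk G u w

Connected : ∀ {n} → Graph n → Set
Connected {n} G = ∀ (u v : Fin n) → Walk G u v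

next : ∀ {m} → Fin (suc m) → Fin (suc m)
next {m} i = suc (toℕ i) mod (suc m)

record Cycle {n} (G : Graph n) : Set where
  field
    len    : ℕ
    vert   : Fin (3 + len) → Fin n
    inj    : Injective _≡_ _≡_ vert
    edges  : ∀ i → Edge G (vert i) (vert (next i))
open Cycle public

CycleEdge : ∀ {n} {G : Graph n} → Cycle G → Fin n → Fin n → Set
CycleEdge C a b =
  ∃ λ i → (vert C i ≡ a × vert C (next i) ≡ b) ⊎ (vert C i ≡ b × vert C (next i) ≡ a)

-- A graph has at most one cycle: any two cycles have the same edge set
-- (cycles are identified with their edge sets, i.e. as subgraphs).
Unicyclic : ∀ {n} → Graph n → Set
Unicyclic G = ∀ (C D : Cycle G) a b → CycleEdge C a b → CycleEdge D a b

Tree : ∀ {n} → Graph n → Set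
Tree G = Connected G × (Cycle G → ⊥)

SqEdge : ∀ {n} → Graph n → Fin n → Fin n → Set
SqEdge T u v = u ≢ v × (Edge T u v ⊎ ∃ λ w → Edge T u w × Edge T w v)

SubgraphOfSquare : ∀ {n} → Graph n → Graph n → Set
SubgraphOfSquare {n} H T = ∀ (u v : Fin n) → Edge H u v → SqEdge T u v

-- Take a breadth-first spanning tree of H; depths differ by at most one along every edge
-- of H.  If the tree contains all edges of H it is the required tree.  Otherwise, by
-- unicyclicity, there is exactly one non-tree edge xy, say with depth x ≤ depth y ≤ depth x + 1.
-- Let y' be y or its parent, so that x and y' have the same depth, and follow their ancestor
-- chains up to the point where they first meet.  Re-hanging these two equally long chains as
-- one path that alternates between them keeps a spanning tree, every vertex of the chains
-- trades two H-neighbours for two new ones (so no degree grows), and consecutive vertices of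
-- the cycle end up at distance at most two.  Both trees are given by parent functions, and
-- a rank that strictly decreases towards the root (twice the depth, plus one on the chain
-- of y') shows that they are trees.

module Submission where

open import Defs hiding (sym)
open import Data.Bool using (true; false)
import Data.Bool as Bool
open import Data.Empty using (⊥; ⊥-elim)
open import Data.Fin using (Fin; zero; suc; toℕ; fromℕ; fromℕ<; inject₁; _≟_)
open import Data.Fin.Properties using (toℕ-injective; toℕ-fromℕ; toℕ-fromℕ<; toℕ-inject₁; toℕ<n; any?)
open import Data.Fin.Subset using (Subset; _∈_; _⊆_; _∪_; _-_; ⁅_⁆; ∣_∣)
open import Data.Fin.Subset.Properties
  using (p⊆q⇒∣p∣≤∣q∣; x∈p⇒∣p-x∣<∣p∣; x∈p∧x≢y⇒x∈p-y; ∣⁅x⁆∣≡1; x∈p∪q⁺; x∈⁅x⁆)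
open import Data.List using ([]; _∷_; foldr; filter; length; map; tabulate; allFin)
open import Data.List.Extrema.Nat using (argmax; f[xs]≤f[argmax])
open import Data.List.Membership.Propositional.Properties using (∈-allFin)
import Data.List.Relation.Unary.All as All
open import Data.Nat using (ℕ; zero; suc; pred; _+_; _∸_; _⊔_; _≤_; _<_; _≤?_; _<?_; z≤n; s≤s)
open import Data.Nat.DivMod using (_%_; m<n⇒m%n≡m; n%n≡0)
open import Data.Nat.Properties hiding (_≟_)
open import Data.Product using (Σ; ∃; _×_; _,_; proj₁; proj₂)
open import Data.Sum using (_⊎_; inj₁; inj₂; [_,_]′)
open import Data.Vec.Base as Vec using (_∷_)
open import Data.Vec.Properties using (lookup∘tabulate; []=⇒lookup; lookup⇒[]=)
open import Function using (_∘_; id; case_of_; mk⇔)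
open import Relation.Nullary using (¬_; Dec; yes; no; does; contradiction)
open import Relation.Nullary.Decidable using (dec-true; dec-false; does-⇔; _×-dec_; _⊎-dec_; ¬?)
open import Relation.Binary.PropositionalEquality

Edge-sym : ∀ {n} (G : Graph n) {u v} → Edge G u v → Edge G v u
Edge-sym G {u} {v} e = trans (Graph.sym G v u) e

Edge⇒≢ : ∀ {n} (G : Graph n) {u v} → Edge G u v → u ≢ v
Edge⇒≢ G e refl with () ← trans (sym e) (irrefl G _)

SqEdge-sym : ∀ {n} (G : Graph n) {u v} → SqEdge G u v → SqEdge G v u
SqEdge-sym G (u≢v , inj₁ uv)             = u≢v ∘ sym , inj₁ (Edge-sym G uv)
SqEdge-sym G (u≢v , inj₂ (w , uw , wv)) = u≢v ∘ sym , inj₂ (w , Edge-sym G wv , Edge-sym G uw)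

CycleEdge-sym : ∀ {n} {G : Graph n} (C : Cycle G) {u v} → CycleEdge C u v → CycleEdge C v u
CycleEdge-sym C (i , inj₁ e) = i , inj₂ e
CycleEdge-sym C (i , inj₂ e) = i , inj₁ e

_++ʷ_ : ∀ {n} {G : Graph n} {u v w} → Walk G u v → Walk G v w → Walk G u w
here ++ʷ q = q
step e p ++ʷ q = step e (p ++ʷ q)

reverseʷ : ∀ {n} {G : Graph n} {u v} → Walk G u v → Walk G v u
reverseʷ here = here
reverseʷ {G = G} (step e p) = reverseʷ p ++ʷ step (Edge-sym G e) here

does⇒ : ∀ {A : Set} (a? : Dec A) → does a? ≡ true → A
does⇒ (yes a) _  = a
does⇒ (no _)  ()

least-witness : ∀ {P : ℕ → Set} → (∀ k → Dec (P k)) → ∀ {m} → P m →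
  ∃ λ k → P k × (∀ {i} → i < k → ¬ P i)
least-witness P? {zero} p = 0 , p , λ ()
least-witness P? {suc m} p with P? 0
... | yes p0 = 0 , p0 , λ ()
... | no ¬p0 with least-witness (P? ∘ suc) p
...   | k , pk , minimal = suc k , pk , λ { {zero} _ → ¬p0 ; {suc i} i<k → minimal (≤-pred i<k) }

maximiser : ∀ {m} (f : Fin (suc m) → ℕ) → ∃ λ i → ∀ j → f j ≤ f i
maximiser {m} f =
  argmax f zero (allFin (suc m)) ,
  λ j → All.lookup (f[xs]≤f[argmax] {f = f} zero (allFin (suc m))) (∈-allFin j)

-- Counting neighbours

∣p∪q∣≤∣p∣+∣q∣ : ∀ {n} (p q : Subset n) → ∣ p ∪ q ∣ ≤ ∣ p ∣ + ∣ q ∣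
∣p∪q∣≤∣p∣+∣q∣ Vec.[] Vec.[] = z≤n
∣p∪q∣≤∣p∣+∣q∣ (true ∷ p) (true ∷ q) =
  s≤s (≤-trans (∣p∪q∣≤∣p∣+∣q∣ p q) (+-monoʳ-≤ ∣ p ∣ (n≤1+n ∣ q ∣)))
∣p∪q∣≤∣p∣+∣q∣ (true ∷ p) (false ∷ q) = s≤s (∣p∪q∣≤∣p∣+∣q∣ p q)
∣p∪q∣≤∣p∣+∣q∣ (false ∷ p) (true ∷ q) =
  ≤-trans (s≤s (∣p∪q∣≤∣p∣+∣q∣ p q)) (≤-reflexive (sym (+-suc ∣ p ∣ ∣ q ∣)))
∣p∪q∣≤∣p∣+∣q∣ (false ∷ p) (false ∷ q) = ∣p∪q∣≤∣p∣+∣q∣ p q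

module _ {n} {p q : Subset n} where
  open ≤-Reasoning

  ∣p∣≤∣q∣-exchange₁ : ∀ {r s} → r ∈ q → p ⊆ (q - r) ∪ ⁅ s ⁆ → ∣ p ∣ ≤ ∣ q ∣
  ∣p∣≤∣q∣-exchange₁ {r} {s} r∈q p⊆ = begin
    ∣ p ∣                   ≤⟨ p⊆q⇒∣p∣≤∣q∣ p⊆ ⟩
    ∣ (q - r) ∪ ⁅ s ⁆ ∣     ≤⟨ ∣p∪q∣≤∣p∣+∣q∣ (q - r) ⁅ s ⁆ ⟩
    ∣ q - r ∣ + ∣ ⁅ s ⁆ ∣   ≡⟨ cong (∣ q - r ∣ +_) (∣⁅x⁆∣≡1 s) ⟩
    ∣ q - r ∣ + 1           ≡⟨ +-comm ∣ q - r ∣ 1 ⟩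
    suc ∣ q - r ∣           ≤⟨ x∈p⇒∣p-x∣<∣p∣ r∈q ⟩
    ∣ q ∣                   ∎

  ∣p∣≤∣q∣-exchange₂ : ∀ {r₁ r₂ s₁ s₂} → r₁ ∈ q → r₂ ∈ q → r₁ ≢ r₂ →
    p ⊆ ((q - r₁) - r₂) ∪ (⁅ s₁ ⁆ ∪ ⁅ s₂ ⁆) → ∣ p ∣ ≤ ∣ q ∣
  ∣p∣≤∣q∣-exchange₂ {r₁} {r₂} {s₁} {s₂} r₁∈q r₂∈q r₁≢r₂ p⊆ = begin
    ∣ p ∣                                   ≤⟨ p⊆q⇒∣p∣≤∣q∣ p⊆ ⟩
    ∣ q₂ ∪ (⁅ s₁ ⁆ ∪ ⁅ s₂ ⁆) ∣              ≤⟨ ∣p∪q∣≤∣p∣+∣q∣ q₂ _ ⟩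
    ∣ q₂ ∣ + ∣ ⁅ s₁ ⁆ ∪ ⁅ s₂ ⁆ ∣            ≤⟨ +-monoʳ-≤ ∣ q₂ ∣ (∣p∪q∣≤∣p∣+∣q∣ ⁅ s₁ ⁆ ⁅ s₂ ⁆) ⟩
    ∣ q₂ ∣ + (∣ ⁅ s₁ ⁆ ∣ + ∣ ⁅ s₂ ⁆ ∣)      ≡⟨ cong (∣ q₂ ∣ +_) (cong₂ _+_ (∣⁅x⁆∣≡1 s₁) (∣⁅x⁆∣≡1 s₂)) ⟩
    ∣ q₂ ∣ + 2                              ≡⟨ +-comm ∣ q₂ ∣ 2 ⟩
    suc (suc ∣ q₂ ∣)                        ≤⟨ s≤s (x∈p⇒∣p-x∣<∣p∣ (x∈p∧x≢y⇒x∈p-y r₂∈q (r₁≢r₂ ∘ sym))) ⟩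
    suc ∣ q - r₁ ∣                          ≤⟨ x∈p⇒∣p-x∣<∣p∣ r₁∈q ⟩
    ∣ q ∣                                   ∎
    where q₂ = (q - r₁) - r₂

module _ {n : ℕ} where

  neighbours : Graph n → Fin n → Subset n
  neighbours G u = Vec.tabulate (adj G u)

  neighbours⁺ : ∀ (G : Graph n) {u v} → Edge G u v → v ∈ neighbours G u
  neighbours⁺ G {u} {v} e = lookup⇒[]= v (neighbours G u) (trans (lookup∘tabulate (adj G u) v) e)

  neighbours⁻ : ∀ (G : Graph n) {u v} → v ∈ neighbours G u → Edge G u v
  neighbours⁻ G {u} {v} v∈ = trans (sym (lookup∘tabulate (adj G u) v)) ([]=⇒lookup v∈)

  degree≡∣neighbours∣ : ∀ (G : Graph n) u → degree G u ≡ ∣ neighbours G u ∣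
  degree≡∣neighbours∣ G u = go id
    where
    go : ∀ {m} (f : Fin m → Fin n) →
      length (filter (λ v → adj G u v Bool.≟ true) (tabulate f)) ≡ ∣ Vec.tabulate (adj G u ∘ f) ∣
    go {zero} f = refl
    go {suc m} f with adj G u (f zero)
    ... | true = cong suc (go (f ∘ suc))
    ... | false = go (f ∘ suc)

  module _ (T H : Graph n) {u : Fin n} where

    degree-mono : (∀ {w} → Edge T u w → Edge H u w) → degree T u ≤ degree H u
    degree-mono T⊆H rewrite degree≡∣neighbours∣ T u | degree≡∣neighbours∣ H u =
      p⊆q⇒∣p∣≤∣q∣ (neighbours⁺ H ∘ T⊆H ∘ neighbours⁻ T)

    degree-exchange₁ : ∀ {r s} → Edge H u r →
      (∀ {w} → Edge T u w → (Edge H u w × w ≢ r) ⊎ w ≡ s) → degree T u ≤ degree H u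
    degree-exchange₁ {r} {s} ur T⊆ rewrite degree≡∣neighbours∣ T u | degree≡∣neighbours∣ H u =
      ∣p∣≤∣q∣-exchange₁ (neighbours⁺ H ur) (place ∘ T⊆ ∘ neighbours⁻ T)
      where
      place : ∀ {w} → (Edge H u w × w ≢ r) ⊎ w ≡ s → w ∈ (neighbours H u - r) ∪ ⁅ s ⁆
      place (inj₁ (uw , w≢r)) = x∈p∪q⁺ (inj₁ (x∈p∧x≢y⇒x∈p-y (neighbours⁺ H uw) w≢r))
      place (inj₂ refl)       = x∈p∪q⁺ (inj₂ (x∈⁅x⁆ s))

    degree-exchange₂ : ∀ {r₁ r₂ s₁ s₂} → Edge H u r₁ → Edge H u r₂ → r₁ ≢ r₂ →
      (∀ {w} → Edge T u w → (Edge H u w × w ≢ r₁ × w ≢ r₂) ⊎ w ≡ s₁ ⊎ w ≡ s₂) →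
      degree T u ≤ degree H u
    degree-exchange₂ {r₁} {r₂} {s₁} {s₂} ur₁ ur₂ r₁≢r₂ T⊆
      rewrite degree≡∣neighbours∣ T u | degree≡∣neighbours∣ H u =
      ∣p∣≤∣q∣-exchange₂ (neighbours⁺ H ur₁) (neighbours⁺ H ur₂) r₁≢r₂ (place ∘ T⊆ ∘ neighbours⁻ T)
      where
      place : ∀ {w} → (Edge H u w × w ≢ r₁ × w ≢ r₂) ⊎ w ≡ s₁ ⊎ w ≡ s₂ →
        w ∈ ((neighbours H u - r₁) - r₂) ∪ (⁅ s₁ ⁆ ∪ ⁅ s₂ ⁆)
      place (inj₁ (uw , w≢r₁ , w≢r₂)) =
        x∈p∪q⁺ (inj₁ (x∈p∧x≢y⇒x∈p-y (x∈p∧x≢y⇒x∈p-y (neighbours⁺ H uw) w≢r₁) w≢r₂))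
      place (inj₂ (inj₁ refl)) = x∈p∪q⁺ (inj₂ (x∈p∪q⁺ (inj₁ (x∈⁅x⁆ s₁))))
      place (inj₂ (inj₂ refl)) = x∈p∪q⁺ (inj₂ (x∈p∪q⁺ (inj₂ (x∈⁅x⁆ s₂))))

maximum-mono : ∀ {A : Set} {f g : A → ℕ} → (∀ x → f x ≤ g x) →
  ∀ xs → foldr _⊔_ 0 (map f xs) ≤ foldr _⊔_ 0 (map g xs)
maximum-mono f≤g []       = z≤n
maximum-mono f≤g (x ∷ xs) = ⊔-mono-≤ (f≤g x) (maximum-mono f≤g xs)

Δ-mono : ∀ {n} (T H : Graph n) → (∀ u → degree T u ≤ degree H u) → Δ T ≤ Δ H
Δ-mono {n} T H deg≤ = maximum-mono deg≤ (allFin n)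

module _ {m : ℕ} where

  toℕ-next-< : ∀ (i : Fin (suc m)) → toℕ i < m → toℕ (next i) ≡ suc (toℕ i)
  toℕ-next-< i i<m = trans (toℕ-fromℕ< _) (m<n⇒m%n≡m (s≤s i<m))

  toℕ-next-last : ∀ (i : Fin (suc m)) → toℕ i ≡ m → toℕ (next i) ≡ 0
  toℕ-next-last i i≡m = trans (toℕ-fromℕ< _) (trans (cong (λ k → suc k % suc m) i≡m) (n%n≡0 (suc m)))

  prev : Fin (suc m) → Fin (suc m)
  prev zero    = fromℕ m
  prev (suc i) = inject₁ i

  next-prev : ∀ (i : Fin (suc m)) → next (prev i) ≡ i
  next-prev zero    = toℕ-injective (toℕ-next-last (fromℕ m) (toℕ-fromℕ m))
  next-prev (suc i) = toℕ-injective (trans (toℕ-next-< (inject₁ i) i<m) (cong suc (toℕ-inject₁ i)))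
    where
    i<m : toℕ (inject₁ i) < m
    i<m = subst (_< m) (sym (toℕ-inject₁ i)) (toℕ<n i)

prev≢next : ∀ {len} (i : Fin (3 + len)) → prev i ≢ next i
prev≢next {len} zero eq
  with trans (sym (toℕ-fromℕ (2 + len))) (trans (cong toℕ eq) (toℕ-next-< {2 + len} zero (s≤s z≤n)))
... | ()
prev≢next {len} (suc i) eq with toℕ (suc i) Data.Nat.≟ 2 + len
... | yes i≡last = 1+n≢0 {len} (trans (suc-injective (sym i≡last)) (trans (sym (toℕ-inject₁ i))
                    (trans (cong toℕ eq) (toℕ-next-last (suc i) i≡last))))
... | no i≢last = m≢1+n+m (toℕ i) {1} (trans (sym (toℕ-inject₁ i)) (trans (cong toℕ eq)
                    (toℕ-next-< (suc i) (≤∧≢⇒< (≤-pred (toℕ<n (suc i))) i≢last))))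

-- Trees given by parent functions

module _ {n} (p : Fin n → Fin n) where

  TreeEdge : Fin n → Fin n → Set
  TreeEdge u v = u ≢ v × (p u ≡ v ⊎ p v ≡ u)

  TreeEdge-sym : ∀ {u v} → TreeEdge u v → TreeEdge v u
  TreeEdge-sym (u≢v , inj₁ pu≡v) = u≢v ∘ sym , inj₂ pu≡v
  TreeEdge-sym (u≢v , inj₂ pv≡u) = u≢v ∘ sym , inj₁ pv≡u

  treeEdge? : ∀ u v → Dec (TreeEdge u v)
  treeEdge? u v = ¬? (u ≟ v) ×-dec (p u ≟ v ⊎-dec p v ≟ u)

  parentGraph : Graph n
  parentGraph = record
    { adj    = λ u v → does (treeEdge? u v)
    ; sym    = λ u v → does-⇔ (mk⇔ TreeEdge-sym TreeEdge-sym) (treeEdge? u v) (treeEdge? v u)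
    ; irrefl = λ u → dec-false (treeEdge? u u) (λ t → proj₁ t refl)
    }

  parentGraph⁺ : ∀ {u v} → TreeEdge u v → Edge parentGraph u v
  parentGraph⁺ {u} {v} = dec-true (treeEdge? u v)

  parentGraph⁻ : ∀ {u v} → Edge parentGraph u v → TreeEdge u v
  parentGraph⁻ {u} {v} = does⇒ (treeEdge? u v)

  parent-TreeEdge : ∀ {u} → u ≢ p u → TreeEdge u (p u)
  parent-TreeEdge u≢pu = u≢pu , inj₁ refl

module _ {n} {p : Fin n → Fin n} {r : Fin n} (rank : Fin n → ℕ)
         (p-root : p r ≡ r) (rank-p : ∀ u → u ≢ r → rank (p u) < rank u) where

  private
    walkToRoot : ∀ k u → rank u < k → Walk (parentGraph p) u r
    walkToRoot (suc k) u u<k with u ≟ r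
    ... | yes refl = here
    ... | no u≢r = step (parentGraph⁺ p (parent-TreeEdge p u≢pu))
                        (walkToRoot k (p u) (<-≤-trans (rank-p u u≢r) (≤-pred u<k)))
      where
      u≢pu : u ≢ p u
      u≢pu u≡pu = <-irrefl (cong rank (sym u≡pu)) (rank-p u u≢r)

  parentGraph-connected : Connected (parentGraph p)
  parentGraph-connected u v = walkToRoot _ u ≤-refl ++ʷ reverseʷ (walkToRoot _ v ≤-refl)

  -- Both cycle-neighbours of a rank-maximal vertex of a cycle must be its parent.
  parentGraph-acyclic : Cycle (parentGraph p) → ⊥
  parentGraph-acyclic C = atMaximum (maximiser (rank ∘ vert C))
    where
    G = parentGraph p

    toParent : ∀ {i} → (∀ j → rank (vert C j) ≤ rank (vert C i)) →
      ∀ k → Edge G (vert C i) (vert C k) → vert C k ≡ p (vert C i)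
    toParent {i} maximal k e = fromTreeEdge (parentGraph⁻ p e)
      where
      notChild : vert C i ≢ vert C k → p (vert C k) ≡ vert C i → Dec (vert C k ≡ r) → ⊥
      notChild v≢w down (yes w≡r) = v≢w (trans (sym down) (trans (cong p w≡r) (trans p-root (sym w≡r))))
      notChild v≢w down (no w≢r)  =
        <⇒≱ (subst (λ t → rank t < rank (vert C k)) down (rank-p _ w≢r)) (maximal k)

      fromTreeEdge : TreeEdge p (vert C i) (vert C k) → vert C k ≡ p (vert C i)
      fromTreeEdge (_   , inj₁ up)   = sym up
      fromTreeEdge (v≢w , inj₂ down) = ⊥-elim (notChild v≢w down (vert C k ≟ r))

    atMaximum : (∃ λ i → ∀ j → rank (vert C j) ≤ rank (vert C i)) → ⊥
    atMaximum (i , maximal) = prev≢next i (inj C (trans (toParent maximal (prev i) prev-edge)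
                                                        (sym (toParent maximal (next i) (edges C i)))))
      where
      prev-edge : Edge G (vert C i) (vert C (prev i))
      prev-edge = Edge-sym G (subst (Edge G (vert C (prev i)) ∘ vert C) (next-prev i) (edges C (prev i)))

  parentGraph-tree : Tree (parentGraph p)
  parentGraph-tree = parentGraph-connected , parentGraph-acyclic

module CycleFromPaths {n} (G : Graph n) (R : Fin n → Fin n → Set)
    (R-sym : ∀ {u v} → R u v → R v u) (R⇒Edge : ∀ {u v} → R u v → Edge G u v)
    (a b : ℕ → Fin n) (p q : ℕ)
    (a-step : ∀ {i} → i < p → R (a i) (a (suc i)))
    (b-step : ∀ {i} → i < q → R (b i) (b (suc i)))
    (a-injective : ∀ {i i'} → i ≤ p → i' ≤ p → a i ≡ a i' → i ≡ i')
    (b-injective : ∀ {i i'} → i ≤ q → i' ≤ q → b i ≡ b i' → i ≡ i')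
    (apart : ∀ {i i'} → i ≤ p → i' < q → a i ≢ b i')
    (top : a p ≡ b q)
    (closing : Edge G (b 0) (a 0))
    (long : 2 ≤ p + q) where

  N : ℕ
  N = p + q

  vertexAt : ℕ → Fin n
  vertexAt i with i ≤? p
  ... | yes _ = a i
  ... | no  _ = b (N ∸ i)

  vertexAt-a : ∀ {i} → i ≤ p → vertexAt i ≡ a i
  vertexAt-a {i} i≤p with i ≤? p
  ... | yes _   = refl
  ... | no  i≰p = contradiction i≤p i≰p

  N∸p≡q : N ∸ p ≡ q
  N∸p≡q = m+n∸m≡n p q

  vertexAt-b : ∀ {i} → p ≤ i → vertexAt i ≡ b (N ∸ i)
  vertexAt-b {i} p≤i with i ≤? p
  ... | no  _   = refl
  ... | yes i≤p with ≤-antisym i≤p p≤i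
  ...   | refl  = trans top (cong b (sym N∸p≡q))

  N∸i<q : ∀ {i} → p < i → i ≤ N → N ∸ i < q
  N∸i<q {i} p<i i≤N = subst (N ∸ i <_) N∸p≡q (∸-monoʳ-< p<i i≤N)

  vertexAt-injective : ∀ {i i'} → i ≤ N → i' ≤ N → vertexAt i ≡ vertexAt i' → i ≡ i'
  vertexAt-injective {i} {i'} i≤N i'≤N eq = cases (i ≤? p) (i' ≤? p)
    where
    cases : Dec (i ≤ p) → Dec (i' ≤ p) → i ≡ i'
    cases (yes i≤p) (yes i'≤p) = a-injective i≤p i'≤p
                                   (trans (sym (vertexAt-a i≤p)) (trans eq (vertexAt-a i'≤p)))
    cases (yes i≤p) (no i'≰p)  =
      contradiction (trans (sym (vertexAt-a i≤p)) (trans eq (vertexAt-b (<⇒≤ (≰⇒> i'≰p)))))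
                    (apart i≤p (N∸i<q (≰⇒> i'≰p) i'≤N))
    cases (no i≰p)  (yes i'≤p) =
      contradiction (trans (sym (vertexAt-a i'≤p)) (trans (sym eq) (vertexAt-b (<⇒≤ (≰⇒> i≰p)))))
                    (apart i'≤p (N∸i<q (≰⇒> i≰p) i≤N))
    cases (no i≰p)  (no i'≰p)  = ∸-cancelˡ-≡ i≤N i'≤N
      (b-injective (<⇒≤ (N∸i<q (≰⇒> i≰p) i≤N)) (<⇒≤ (N∸i<q (≰⇒> i'≰p) i'≤N))
        (trans (sym (vertexAt-b (<⇒≤ (≰⇒> i≰p)))) (trans eq (vertexAt-b (<⇒≤ (≰⇒> i'≰p))))))

  vertexAt-step : ∀ {i} → i < N → R (vertexAt i) (vertexAt (suc i))
  vertexAt-step {i} i<N = cases (suc i ≤? p)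
    where
    cases : Dec (suc i ≤ p) → R (vertexAt i) (vertexAt (suc i))
    cases (yes i<p) = subst₂ R (sym (vertexAt-a (<⇒≤ i<p))) (sym (vertexAt-a i<p)) (a-step i<p)
    cases (no i≮p)  = subst₂ R (sym (vertexAt-b (≤-pred p<1+i))) (sym (vertexAt-b (<⇒≤ p<1+i)))
                        (R-sym (subst (λ t → R (b (N ∸ suc i)) (b t)) (sym (+-∸-assoc 1 i<N))
                          (b-step (N∸i<q p<1+i i<N))))
      where
      p<1+i : p < suc i
      p<1+i = ≰⇒> i≮p

  vertexAt-0 : vertexAt 0 ≡ a 0
  vertexAt-0 = vertexAt-a z≤n

  vertexAt-N : vertexAt N ≡ b 0
  vertexAt-N = trans (vertexAt-b (m≤m+n p q)) (cong b (n∸n≡0 N))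

  len' : ℕ
  len' = N ∸ 2

  last≡N : 2 + len' ≡ N
  last≡N = m+[n∸m]≡n long

  index≤N : ∀ (k : Fin (3 + len')) → toℕ k ≤ N
  index≤N k = subst (toℕ k ≤_) last≡N (≤-pred (toℕ<n k))

  step-or-closing : ∀ (k : Fin (3 + len')) →
    R (vertexAt (toℕ k)) (vertexAt (toℕ (next k))) ⊎
    (vertexAt (toℕ k) ≡ b 0 × vertexAt (toℕ (next k)) ≡ a 0)
  step-or-closing k with toℕ k <? 2 + len'
  ... | yes k<last = inj₁ (subst (λ t → R (vertexAt (toℕ k)) (vertexAt t)) (sym (toℕ-next-< k k<last))
                       (vertexAt-step (subst (toℕ k <_) last≡N k<last)))
  ... | no k≮last  = inj₂ (trans (cong vertexAt k≡N) vertexAt-N ,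
                       trans (cong vertexAt (toℕ-next-last k (trans k≡N (sym last≡N)))) vertexAt-0)
    where
    k≡N : toℕ k ≡ N
    k≡N = ≤-antisym (index≤N k) (subst (_≤ toℕ k) last≡N (≮⇒≥ k≮last))

  cycle : Cycle G
  cycle = record
    { len   = len'
    ; vert  = vertexAt ∘ toℕ
    ; inj   = λ {k} {k'} eq → toℕ-injective (vertexAt-injective (index≤N k) (index≤N k') eq)
    ; edges = λ k → [ R⇒Edge , (λ { (u≡b₀ , v≡a₀) → subst₂ (Edge G) (sym u≡b₀) (sym v≡a₀) closing }) ]′
                      (step-or-closing k)
    }

  closing∈cycle : CycleEdge cycle (a 0) (b 0)
  closing∈cycle = last , inj₂ (trans (cong vertexAt (trans (toℕ-fromℕ (2 + len')) last≡N)) vertexAt-N ,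
                                trans (cong vertexAt (toℕ-next-last last (toℕ-fromℕ (2 + len')))) vertexAt-0)
    where
    last = fromℕ (2 + len')

  cycle-edges : ∀ {u v} → CycleEdge cycle u v → R u v ⊎ (u ≡ a 0 × v ≡ b 0) ⊎ (u ≡ b 0 × v ≡ a 0)
  cycle-edges (k , inj₁ (refl , refl)) with step-or-closing k
  ... | inj₁ along              = inj₁ along
  ... | inj₂ (u≡b₀ , v≡a₀)      = inj₂ (inj₂ (u≡b₀ , v≡a₀))
  cycle-edges (k , inj₂ (refl , refl)) with step-or-closing k
  ... | inj₁ along              = inj₁ (R-sym along)
  ... | inj₂ (v≡b₀ , u≡a₀)      = inj₂ (inj₁ (u≡a₀ , v≡b₀))

-- Breadth-first trees

record BFSTree {n} (H : Graph n) (r : Fin n) : Set where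
  field
    depth        : Fin n → ℕ
    parent       : Fin n → Fin n
    depth-root   : depth r ≡ 0
    depth≡0      : ∀ {w} → depth w ≡ 0 → w ≡ r
    depth-parent : ∀ w → depth (parent w) ≡ pred (depth w)
    parent-edge  : ∀ {w} → w ≢ r → Edge H w (parent w)
    depth-edge   : ∀ {u v} → Edge H u v → depth v ≤ suc (depth u)

module _ {n} (H : Graph n) (r : Fin n) where

  WithinDistance : ℕ → Fin n → Set
  WithinDistance zero    w = w ≡ r
  WithinDistance (suc k) w = WithinDistance k w ⊎ ∃ λ u → Edge H w u × WithinDistance k u

  withinDistance? : ∀ k w → Dec (WithinDistance k w)
  withinDistance? zero    w = w ≟ r
  withinDistance? (suc k) w =
    withinDistance? k w ⊎-dec any? (λ u → (adj H w u Bool.≟ true) ×-dec withinDistance? k u)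

  walk⇒WithinDistance : ∀ {w} → Walk H w r → ∃ λ k → WithinDistance k w
  walk⇒WithinDistance here = 0 , refl
  walk⇒WithinDistance (step e p) with walk⇒WithinDistance p
  ... | k , within = suc k , inj₂ (_ , e , within)

  module _ (connected : Connected H) where

    private
      shortest : ∀ w → ∃ λ k → WithinDistance k w × (∀ {i} → i < k → ¬ WithinDistance i w)
      shortest w = least-witness (λ k → withinDistance? k w) (proj₂ (walk⇒WithinDistance (connected w r)))

      depth : Fin n → ℕ
      depth w = proj₁ (shortest w)

      depth-within : ∀ w → WithinDistance (depth w) w
      depth-within w = proj₁ (proj₂ (shortest w))

      depth-minimal : ∀ {w i} → WithinDistance i w → depth w ≤ i
      depth-minimal {w} within = ≮⇒≥ (λ i<d → proj₂ (proj₂ (shortest w)) i<d within)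

      nextHop : ∀ {w k} → depth w ≡ suc k → ∃ λ u → Edge H w u × depth u ≡ k
      nextHop {w} {k} d≡1+k with subst (λ t → WithinDistance t w) d≡1+k (depth-within w)
      ... | inj₁ within = contradiction (subst (k <_) (sym d≡1+k) ≤-refl) (≤⇒≯ (depth-minimal within))
      ... | inj₂ (u , e , within) = u , e , ≤-antisym (depth-minimal within)
            (≤-pred (subst (_≤ suc (depth u)) d≡1+k (depth-minimal (inj₂ (u , e , depth-within u)))))

      parentAt : ∀ w k → depth w ≡ k → Fin n
      parentAt w zero    _     = w
      parentAt w (suc k) d≡1+k = proj₁ (nextHop d≡1+k)

      parent : Fin n → Fin n
      parent w = parentAt w (depth w) refl

      depth-parent : ∀ w → depth (parent w) ≡ pred (depth w)
      depth-parent w = go (depth w) refl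
        where
        go : ∀ k (d≡k : depth w ≡ k) → depth (parentAt w k d≡k) ≡ pred k
        go zero    d≡0   = d≡0
        go (suc k) d≡1+k = proj₂ (proj₂ (nextHop d≡1+k))

      parent-edge : ∀ {w} → w ≢ r → Edge H w (parent w)
      parent-edge {w} w≢r = go (depth w) refl
        where
        go : ∀ k (d≡k : depth w ≡ k) → Edge H w (parentAt w k d≡k)
        go zero    d≡0   = contradiction (subst (λ k → WithinDistance k w) d≡0 (depth-within w)) w≢r
        go (suc k) d≡1+k = proj₁ (proj₂ (nextHop d≡1+k))

    bfsTree : BFSTree H r
    bfsTree = record
      { depth        = depth
      ; parent       = parent
      ; depth-root   = n≤0⇒n≡0 (depth-minimal refl)
      ; depth≡0      = λ {w} d≡0 → subst (λ k → WithinDistance k w) d≡0 (depth-within w)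
      ; depth-parent = depth-parent
      ; parent-edge  = parent-edge
      ; depth-edge   = λ {u} e → depth-minimal (inj₂ (u , Edge-sym H e , depth-within u))
      }

module BFS {n} {H : Graph n} {r : Fin n} (B : BFSTree H r) where
  open BFSTree B public

  parent-root : parent r ≡ r
  parent-root = depth≡0 (trans (depth-parent r) (cong pred depth-root))

  depth≢0 : ∀ {w} → w ≢ r → depth w ≢ 0
  depth≢0 w≢r = w≢r ∘ depth≡0

  depth-child : ∀ {w} → w ≢ r → depth w ≡ suc (depth (parent w))
  depth-child {w} w≢r with depth w | depth-parent w | depth≢0 w≢r
  ... | zero  | _  | d≢0 = contradiction refl d≢0
  ... | suc d | dp | _   = cong suc (sym dp)

  depth-parent-< : ∀ w → w ≢ r → depth (parent w) < depth w
  depth-parent-< w w≢r = ≤-reflexive (sym (depth-child w≢r))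

  ≢parent⇒≢root : ∀ {w} → w ≢ parent w → w ≢ r
  ≢parent⇒≢root w≢pw refl = w≢pw (sym parent-root)

  ≢parent : ∀ {w} → w ≢ r → w ≢ parent w
  ≢parent w≢r w≡pw = <-irrefl (cong depth (sym w≡pw)) (depth-parent-< _ w≢r)

  parent²≢ : ∀ {w} → w ≢ parent w → parent (parent w) ≢ w
  parent²≢ {w} w≢pw ppw≡w = m≢1+n+m (depth w) {1} (begin
    depth w                            ≡⟨ depth-child w≢r ⟩
    suc (depth (parent w))             ≡⟨ cong suc (depth-child pw≢r) ⟩
    suc (suc (depth (parent (parent w)))) ≡⟨ cong (λ t → 2 + depth t) ppw≡w ⟩
    suc (suc (depth w))                ∎)
    where
    open ≡-Reasoning
    w≢r : w ≢ r
    w≢r refl = w≢pw (sym parent-root)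
    pw≢r : parent w ≢ r
    pw≢r pw≡r = w≢r (trans (sym ppw≡w) (trans (cong parent pw≡r) parent-root))

  tree : Graph n
  tree = parentGraph parent

  tree-isTree : Tree tree
  tree-isTree = parentGraph-tree depth parent-root depth-parent-<

  TreeEdge⇒Edge : ∀ {u v} → TreeEdge parent u v → Edge H u v
  TreeEdge⇒Edge {u} {v} (u≢v , inj₁ refl) = parent-edge (λ { refl → u≢v (sym parent-root) })
  TreeEdge⇒Edge {u} {v} (u≢v , inj₂ refl) = Edge-sym H (parent-edge (λ { refl → u≢v parent-root }))

  child-edge : ∀ {w v} → w ≢ v → parent w ≡ v → Edge H v w
  child-edge w≢v pw≡v = TreeEdge⇒Edge (TreeEdge-sym parent (w≢v , inj₁ pw≡v))

  ancestor : ℕ → Fin n → Fin n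
  ancestor zero    w = w
  ancestor (suc k) w = parent (ancestor k w)

  depth-ancestor : ∀ k w → depth (ancestor k w) ≡ depth w ∸ k
  depth-ancestor zero    w = refl
  depth-ancestor (suc k) w = begin
    depth (parent (ancestor k w)) ≡⟨ depth-parent (ancestor k w) ⟩
    pred (depth (ancestor k w))   ≡⟨ cong pred (depth-ancestor k w) ⟩
    pred (depth w ∸ k)            ≡⟨ pred[m∸n]≡m∸[1+n] (depth w) k ⟩
    depth w ∸ suc k               ∎
    where open ≡-Reasoning

  ancestor-+ : ∀ a b w → ancestor (a + b) w ≡ ancestor a (ancestor b w)
  ancestor-+ zero    b w = refl
  ancestor-+ (suc a) b w = cong parent (ancestor-+ a b w)

  ancestor-root : ∀ {k w} → depth w ≤ k → ancestor k w ≡ r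
  ancestor-root {k} {w} d≤k = depth≡0 (trans (depth-ancestor k w) (m≤n⇒m∸n≡0 d≤k))

  ancestor≢root : ∀ {k w} → k < depth w → ancestor k w ≢ r
  ancestor≢root {k} {w} k<d eq =
    <⇒≢ (m<n⇒0<n∸m k<d) (trans (sym depth-root) (trans (cong depth (sym eq)) (depth-ancestor k w)))

  ancestor-cancel : ∀ {u v i i'} → depth u ≡ depth v → i ≤ depth u → i' ≤ depth v →
    ancestor i u ≡ ancestor i' v → i ≡ i'
  ancestor-cancel {u} {v} {i} {i'} du≡dv i≤ i'≤ eq = ∸-cancelˡ-≡ i≤ (subst (i' ≤_) (sym du≡dv) i'≤) (begin
    depth u ∸ i            ≡⟨ depth-ancestor i u ⟨
    depth (ancestor i u)   ≡⟨ cong depth eq ⟩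
    depth (ancestor i' v)  ≡⟨ depth-ancestor i' v ⟩
    depth v ∸ i'           ≡⟨ cong (_∸ i') du≡dv ⟨
    depth u ∸ i'           ∎)
    where open ≡-Reasoning

  ancestor-TreeEdge : ∀ {k w} → k < depth w → TreeEdge parent (ancestor k w) (ancestor (suc k) w)
  ancestor-TreeEdge k<d = parent-TreeEdge parent (≢parent (ancestor≢root k<d))

  NonTreeEdge : Fin n → Fin n → Set
  NonTreeEdge u v = Edge H u v × parent u ≢ v × parent v ≢ u

  NonTreeEdge-sym : ∀ {u v} → NonTreeEdge u v → NonTreeEdge v u
  NonTreeEdge-sym (uv , pu≢v , pv≢u) = Edge-sym H uv , pv≢u , pu≢v

  nonTreeEdge? : ∀ u v → Dec (NonTreeEdge u v)
  nonTreeEdge? u v = (adj H u v Bool.≟ true) ×-dec (¬? (parent u ≟ v) ×-dec ¬? (parent v ≟ u))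

  NonTreeEdge⇒¬TreeEdge : ∀ {u v} → NonTreeEdge u v → ¬ TreeEdge parent u v
  NonTreeEdge⇒¬TreeEdge (_ , pu≢v , _) (_ , inj₁ pu≡v) = pu≢v pu≡v
  NonTreeEdge⇒¬TreeEdge (_ , _ , pv≢u) (_ , inj₂ pv≡u) = pv≢u pv≡u

-- The fundamental cycle of a chord

module Chord {n} {H : Graph n} {r : Fin n} (B : BFSTree H r)
             {x y : Fin n} (xy : BFS.NonTreeEdge B x y) (x≤y : BFSTree.depth B x ≤ BFSTree.depth B y) where
  open BFS B

  D c : ℕ
  D = depth x
  c = depth y ∸ D

  c≤1 : c ≤ 1
  c≤1 = ≤-trans (∸-monoˡ-≤ D (depth-edge (proj₁ xy))) (≤-reflexive (m+n∸n≡m 1 D))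

  depth-y : depth y ≡ c + D
  depth-y = sym (m∸n+n≡m x≤y)

  -- y↑ starts from y raised by c ∈ {0, 1} levels, to the depth of x.
  x↑ y↑ : ℕ → Fin n
  x↑ k = ancestor k x
  y↑ k = ancestor k (ancestor c y)

  depth-x↑ : ∀ k → depth (x↑ k) ≡ D ∸ k
  depth-x↑ k = depth-ancestor k x

  depth-x↑≤D : ∀ k → depth (x↑ k) ≤ D
  depth-x↑≤D k = subst (_≤ D) (sym (depth-x↑ k)) (m∸n≤m D k)

  depth-y↑0 : depth (y↑ 0) ≡ D
  depth-y↑0 = trans (depth-ancestor c y) (trans (cong (_∸ c) depth-y) (m+n∸m≡n c D))

  depth-y↑ : ∀ k → depth (y↑ k) ≡ D ∸ k
  depth-y↑ k = trans (depth-ancestor k (y↑ 0)) (cong (_∸ k) depth-y↑0)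

  depth-y↑≤D : ∀ k → depth (y↑ k) ≤ D
  depth-y↑≤D k = subst (_≤ D) (sym (depth-y↑ k)) (m∸n≤m D k)

  x≢y↑0 : x ≢ y↑ 0
  x≢y↑0 with n≤1⇒n≡0∨n≡1 c≤1
  ... | inj₁ c≡0 = λ x≡ → Edge⇒≢ H (proj₁ xy) (trans x≡ (cong (λ k → ancestor k y) c≡0))
  ... | inj₂ c≡1 = λ x≡ → proj₂ (proj₂ xy) (sym (trans x≡ (cong (λ k → ancestor k y) c≡1)))

  x↑D≡y↑D : x↑ D ≡ y↑ D
  x↑D≡y↑D = trans (ancestor-root {D} {x} ≤-refl) (sym (ancestor-root {D} {y↑ 0} (≤-reflexive depth-y↑0)))

  private
    meeting : ∃ λ j → x↑ j ≡ y↑ j × (∀ {i} → i < j → x↑ i ≢ y↑ i)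
    meeting = least-witness (λ k → x↑ k ≟ y↑ k) {D} x↑D≡y↑D

  meet : ℕ
  meet = proj₁ meeting

  x↑meet≡y↑meet : x↑ meet ≡ y↑ meet
  x↑meet≡y↑meet = proj₁ (proj₂ meeting)

  meet≤D : meet ≤ D
  meet≤D = ≮⇒≥ (λ D<meet → proj₂ (proj₂ meeting) D<meet x↑D≡y↑D)

  1≤meet : 1 ≤ meet
  1≤meet with meet | x↑meet≡y↑meet
  ... | zero  | x≡y↑0 = contradiction x≡y↑0 x≢y↑0
  ... | suc _ | _     = s≤s z≤n

  x↑-injective : ∀ {i i'} → i ≤ D → i' ≤ D → x↑ i ≡ x↑ i' → i ≡ i'
  x↑-injective = ancestor-cancel refl

  ≤D⇒≤depth-y↑0 : ∀ {i} → i ≤ D → i ≤ depth (y↑ 0)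
  ≤D⇒≤depth-y↑0 {i} = subst (i ≤_) (sym depth-y↑0)

  y↑-injective : ∀ {i i'} → i ≤ D → i' ≤ D → y↑ i ≡ y↑ i' → i ≡ i'
  y↑-injective i≤D i'≤D = ancestor-cancel refl (≤D⇒≤depth-y↑0 i≤D) (≤D⇒≤depth-y↑0 i'≤D)

  chains-meet : ∀ {i i'} → i ≤ D → i' ≤ D → x↑ i ≡ y↑ i' → i ≡ i' × meet ≤ i
  chains-meet {i} {i'} i≤D i'≤D eq =
    i≡i' , ≮⇒≥ (λ i<meet → proj₂ (proj₂ meeting) i<meet (subst (λ t → x↑ i ≡ y↑ t) (sym i≡i') eq))
    where
    i≡i' : i ≡ i'
    i≡i' = ancestor-cancel (sym depth-y↑0) i≤D (≤D⇒≤depth-y↑0 i'≤D) eq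

  <meet⇒≤D : ∀ {i} → i < meet → i ≤ D
  <meet⇒≤D i<meet = ≤-trans (<⇒≤ i<meet) meet≤D

  x↑≢y↑ : ∀ {i i'} → i < meet → i' ≤ D → x↑ i ≢ y↑ i'
  x↑≢y↑ i<meet i'≤D eq = <⇒≱ i<meet (proj₂ (chains-meet (<meet⇒≤D i<meet) i'≤D eq))

  y↑≢x↑ : ∀ {i i'} → i < meet → i' ≤ D → y↑ i ≢ x↑ i'
  y↑≢x↑ {i} i<meet i'≤D eq with chains-meet i'≤D (<meet⇒≤D i<meet) (sym eq)
  ... | refl , meet≤i = <⇒≱ i<meet meet≤i

  D<depth-ancestor-y : ∀ {i'} → i' < c → D < depth (ancestor i' y)
  D<depth-ancestor-y {i'} i'<c = begin-strict
    D                     <⟨ +-monoˡ-< D (m<n⇒0<n∸m i'<c) ⟩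
    (c ∸ i') + D          ≡⟨ +-∸-comm D (<⇒≤ i'<c) ⟨
    (c + D) ∸ i'          ≡⟨ cong (_∸ i') depth-y ⟨
    depth y ∸ i'          ≡⟨ depth-ancestor i' y ⟨
    depth (ancestor i' y) ∎
    where open ≤-Reasoning

  private
    ancestor-y≡y↑ : ∀ {i'} → c ≤ i' → ancestor i' y ≡ y↑ (i' ∸ c)
    ancestor-y≡y↑ {i'} c≤i' =
      trans (cong (λ t → ancestor t y) (sym (m∸n+n≡m c≤i'))) (ancestor-+ (i' ∸ c) c y)

    shifted<meet : ∀ {i'} → c ≤ i' → i' < meet + c → i' ∸ c < meet
    shifted<meet {i'} c≤i' i'<meet+c = subst (i' ∸ c <_) (m+n∸n≡m meet c) (∸-monoˡ-< i'<meet+c c≤i')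

    apart : ∀ {i i'} → i ≤ meet → i' < meet + c → x↑ i ≢ ancestor i' y
    apart {i} {i'} i≤meet i'<meet+c eq with c ≤? i'
    ... | no c≰i'  = <⇒≱ (D<depth-ancestor-y (≰⇒> c≰i')) (subst (_≤ D) (cong depth eq) (depth-x↑≤D i))
    ... | yes c≤i' with chains-meet (≤-trans i≤meet meet≤D) (<meet⇒≤D (shifted<meet c≤i' i'<meet+c))
                          (trans eq (ancestor-y≡y↑ c≤i'))
    ...   | refl , meet≤i = <⇒≱ (shifted<meet c≤i' i'<meet+c) meet≤i

  meet+c≤depth-y : meet + c ≤ depth y
  meet+c≤depth-y = ≤-trans (+-monoˡ-≤ c meet≤D) (≤-reflexive (trans (+-comm D c) (sym depth-y)))

  module Fundamental = CycleFromPaths H (TreeEdge parent) (TreeEdge-sym parent) TreeEdge⇒Edge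
    x↑ (λ k → ancestor k y) meet (meet + c)
    (λ i<meet → ancestor-TreeEdge (<-≤-trans i<meet meet≤D))
    (λ i<meet+c → ancestor-TreeEdge (<-≤-trans i<meet+c meet+c≤depth-y))
    (λ i≤meet i'≤meet → x↑-injective (≤-trans i≤meet meet≤D) (≤-trans i'≤meet meet≤D))
    (λ i≤ i'≤ → ancestor-cancel refl (≤-trans i≤ meet+c≤depth-y) (≤-trans i'≤ meet+c≤depth-y))
    apart
    (trans x↑meet≡y↑meet (sym (ancestor-+ meet c y)))
    (Edge-sym H (proj₁ xy))
    (+-mono-≤ 1≤meet (≤-trans 1≤meet (m≤m+n meet c)))

-- The zigzag tree

module Zigzag {n} {H : Graph n} {r : Fin n} (B : BFSTree H r)
              {x y : Fin n} (xy : BFS.NonTreeEdge B x y) (x≤y : BFSTree.depth B x ≤ BFSTree.depth B y) where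
  open BFS B
  open Chord B xy x≤y

  data Position (w : Fin n) : Set where
    on-x : ∀ {k} → k < meet → x↑ k ≡ w → Position w
    on-y : ∀ {k} → k < meet → y↑ k ≡ w → Position w
    off  : (∀ {k} → k < meet → x↑ k ≢ w) → (∀ {k} → k < meet → y↑ k ≢ w) → Position w

  position : ∀ w → Position w
  position w with any? (λ (k : Fin meet) → x↑ (toℕ k) ≟ w) | any? (λ (k : Fin meet) → y↑ (toℕ k) ≟ w)
  ... | yes (k , eq) | _            = on-x (toℕ<n k) eq
  ... | no _         | yes (k , eq) = on-y (toℕ<n k) eq
  ... | no ¬on-x     | no ¬on-y     =
    off (λ k<meet eq → ¬on-x (below k<meet eq)) (λ k<meet eq → ¬on-y (below k<meet eq))
    where
    below : ∀ {f : ℕ → Fin n} {k} → k < meet → f k ≡ w → ∃ λ (i : Fin meet) → f (toℕ i) ≡ w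
    below {f} k<meet eq = fromℕ< k<meet , trans (cong f (toℕ-fromℕ< k<meet)) eq

  -- The two chains below the meeting point are re-hung as the zigzag path
  -- y↑ 0 – x↑ 0 – y↑ 1 – x↑ 1 – ⋯ – y↑ (meet-1) – x↑ (meet-1) – x↑ meet;
  -- every other vertex keeps its breadth-first parent.
  zigzagParent : Fin n → Fin n
  zigzagParent w with position w
  ... | on-x {k} _ _ = y↑ (suc k)
  ... | on-y {k} _ _ = x↑ k
  ... | off _ _      = parent w

  zigzagRank : Fin n → ℕ
  zigzagRank w with position w
  ... | on-y _ _ = suc (depth w + depth w)
  ... | _        = depth w + depth w

  zigzagParent-x : ∀ {k} → k < meet → zigzagParent (x↑ k) ≡ y↑ (suc k)
  zigzagParent-x {k} k<meet with position (x↑ k)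
  ... | on-x k'<meet eq = cong (y↑ ∘ suc) (x↑-injective (<meet⇒≤D k'<meet) (<meet⇒≤D k<meet) eq)
  ... | on-y k'<meet eq = contradiction eq (y↑≢x↑ k'<meet (<meet⇒≤D k<meet))
  ... | off ¬on-x _     = contradiction refl (¬on-x k<meet)

  zigzagParent-y : ∀ {k} → k < meet → zigzagParent (y↑ k) ≡ x↑ k
  zigzagParent-y {k} k<meet with position (y↑ k)
  ... | on-x k'<meet eq = contradiction eq (x↑≢y↑ k'<meet (<meet⇒≤D k<meet))
  ... | on-y k'<meet eq = cong x↑ (y↑-injective (<meet⇒≤D k'<meet) (<meet⇒≤D k<meet) eq)
  ... | off _ ¬on-y     = contradiction refl (¬on-y k<meet)

  zigzagParent-off : ∀ {w} → (∀ {k} → k < meet → x↑ k ≢ w) → (∀ {k} → k < meet → y↑ k ≢ w) →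
    zigzagParent w ≡ parent w
  zigzagParent-off {w} ¬on-x ¬on-y with position w
  ... | on-x k<meet eq = contradiction eq (¬on-x k<meet)
  ... | on-y k<meet eq = contradiction eq (¬on-y k<meet)
  ... | off _ _        = refl

  zigzagRank-bounds : ∀ w → depth w + depth w ≤ zigzagRank w × zigzagRank w ≤ suc (depth w + depth w)
  zigzagRank-bounds w with position w
  ... | on-x _ _ = ≤-refl , n≤1+n _
  ... | on-y _ _ = n≤1+n _ , ≤-refl
  ... | off _ _  = ≤-refl , n≤1+n _

  zigzagRank-x : ∀ {k} → k < meet → zigzagRank (x↑ k) ≡ depth (x↑ k) + depth (x↑ k)
  zigzagRank-x {k} k<meet with position (x↑ k)
  ... | on-x _ _        = refl
  ... | on-y k'<meet eq = contradiction eq (y↑≢x↑ k'<meet (<meet⇒≤D k<meet))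
  ... | off _ _         = refl

  zigzagRank-y : ∀ {k} → k < meet → zigzagRank (y↑ k) ≡ suc (depth (y↑ k) + depth (y↑ k))
  zigzagRank-y {k} k<meet with position (y↑ k)
  ... | on-x k'<meet eq = contradiction eq (x↑≢y↑ k'<meet (<meet⇒≤D k<meet))
  ... | on-y _ _        = refl
  ... | off _ ¬on-y     = contradiction refl (¬on-y k<meet)

  zigzagRank-depth-< : ∀ {u w} → depth u < depth w → zigzagRank u < zigzagRank w
  zigzagRank-depth-< {u} {w} du<dw = begin-strict
    zigzagRank u               ≤⟨ proj₂ (zigzagRank-bounds u) ⟩
    suc (depth u + depth u)    ≡⟨ +-suc (depth u) (depth u) ⟨
    depth u + suc (depth u)    ≤⟨ +-monoʳ-≤ (depth u) du<dw ⟩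
    depth u + depth w          <⟨ +-monoˡ-< (depth w) du<dw ⟩
    depth w + depth w          ≤⟨ proj₁ (zigzagRank-bounds w) ⟩
    zigzagRank w               ∎
    where open ≤-Reasoning

  zigzagRank-decreasing-at : ∀ {w} → Position w → w ≢ r → zigzagRank (zigzagParent w) < zigzagRank w
  zigzagRank-decreasing-at (on-x {k} k<meet refl) _ =
    subst (λ t → zigzagRank t < zigzagRank (x↑ k)) (sym (zigzagParent-x k<meet))
      (zigzagRank-depth-< (subst₂ _<_ (sym (depth-y↑ (suc k))) (sym (depth-x↑ k))
        (∸-monoʳ-< ≤-refl (<-≤-trans k<meet meet≤D))))
  zigzagRank-decreasing-at (on-y {k} k<meet refl) _ = begin-strict
    zigzagRank (zigzagParent (y↑ k))   ≡⟨ cong zigzagRank (zigzagParent-y k<meet) ⟩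
    zigzagRank (x↑ k)                  ≡⟨ zigzagRank-x k<meet ⟩
    depth (x↑ k) + depth (x↑ k)        ≡⟨ cong (λ t → t + t) (trans (depth-x↑ k) (sym (depth-y↑ k))) ⟩
    depth (y↑ k) + depth (y↑ k)        <⟨ ≤-refl ⟩
    suc (depth (y↑ k) + depth (y↑ k))  ≡⟨ zigzagRank-y k<meet ⟨
    zigzagRank (y↑ k)                  ∎
    where open ≤-Reasoning
  zigzagRank-decreasing-at {w} (off ¬on-x ¬on-y) w≢r =
    subst (λ t → zigzagRank t < zigzagRank w) (sym (zigzagParent-off ¬on-x ¬on-y))
      (zigzagRank-depth-< (depth-parent-< w w≢r))

  x↑≢r : ∀ {k} → k < meet → x↑ k ≢ r
  x↑≢r k<meet = ancestor≢root (<-≤-trans k<meet meet≤D)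

  y↑≢r : ∀ {k} → k < meet → y↑ k ≢ r
  y↑≢r k<meet = ancestor≢root (<-≤-trans k<meet (≤D⇒≤depth-y↑0 meet≤D))

  zigzagParent-root : zigzagParent r ≡ r
  zigzagParent-root = trans (zigzagParent-off x↑≢r y↑≢r) parent-root

  zigzag : Graph n
  zigzag = parentGraph zigzagParent

  zigzag-isTree : Tree zigzag
  zigzag-isTree = parentGraph-tree zigzagRank zigzagParent-root (zigzagRank-decreasing-at ∘ position)

  data Child (w v : Fin n) : Set where
    x-child   : ∀ {k} → k < meet → w ≡ x↑ k → v ≡ y↑ (suc k) → Child w v
    y-child   : ∀ {k} → k < meet → w ≡ y↑ k → v ≡ x↑ k → Child w v
    off-child : (∀ {k} → k < meet → x↑ k ≢ w) → (∀ {k} → k < meet → y↑ k ≢ w) → parent w ≡ v → Child w v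

  child : ∀ {w v} → Position w → zigzagParent w ≡ v → Child w v
  child (on-x k<meet refl) down = x-child k<meet refl (trans (sym down) (zigzagParent-x k<meet))
  child (on-y k<meet refl) down = y-child k<meet refl (trans (sym down) (zigzagParent-y k<meet))
  child (off ¬on-x ¬on-y)  down = off-child ¬on-x ¬on-y (trans (sym (zigzagParent-off ¬on-x ¬on-y)) down)

  zigzag-neighbour : ∀ {v w} → Edge zigzag v w → zigzagParent v ≡ w ⊎ Child w v
  zigzag-neighbour {v} {w} e = [ inj₁ , inj₂ ∘ child (position w) ]′ (proj₂ (parentGraph⁻ zigzagParent e))

  off-child-edge : ∀ {v w} → Edge zigzag v w → parent w ≡ v → Edge H v w × w ≢ parent v
  off-child-edge {v} {w} e pw≡v = child-edge w≢v pw≡v , w≢pv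
    where
    w≢v : w ≢ v
    w≢v = proj₁ (parentGraph⁻ zigzagParent e) ∘ sym
    w≢pv : w ≢ parent v
    w≢pv w≡pv = parent²≢ (λ w≡pw → w≢v (trans w≡pw pw≡v)) (trans (cong parent pw≡v) (sym w≡pv))

  degree-x : ∀ {k} → k < meet → degree zigzag (x↑ k) ≤ degree H (x↑ k)
  degree-x {k} k<meet =
    degree-exchange₂ zigzag H (parent-edge (x↑≢r k<meet)) (lower-edge k k<meet) (parent≢lower k k<meet)
      neighbour
    where
    lower : ℕ → Fin n
    lower zero    = y
    lower (suc k) = x↑ k

    lower-edge : ∀ j → j < meet → Edge H (x↑ j) (lower j)
    lower-edge zero    _          = proj₁ xy
    lower-edge (suc j) j+1<meet   = child-edge (≢parent (x↑≢r (<-trans (n<1+n j) j+1<meet))) refl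

    parent≢lower : ∀ j → j < meet → x↑ (suc j) ≢ lower j
    parent≢lower zero    _        = proj₁ (proj₂ xy)
    parent≢lower (suc j) j+1<meet eq =
      m≢1+n+m j {1} (sym (x↑-injective (<-≤-trans j+1<meet meet≤D) (<meet⇒≤D (<-trans (n<1+n j) j+1<meet))
                                       eq))

    off≢lower : ∀ j → j < meet → ∀ {w} → (∀ {k} → k < meet → x↑ k ≢ w) → parent w ≡ x↑ j → w ≢ lower j
    off≢lower zero    _        _     pw≡ w≡ = proj₂ (proj₂ xy) (trans (cong parent (sym w≡)) pw≡)
    off≢lower (suc j) j+1<meet ¬on-x _   w≡ = ¬on-x (<-trans (n<1+n j) j+1<meet) (sym w≡)

    neighbour : ∀ {w} → Edge zigzag (x↑ k) w →
      (Edge H (x↑ k) w × w ≢ x↑ (suc k) × w ≢ lower k) ⊎ w ≡ y↑ (suc k) ⊎ w ≡ y↑ k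
    neighbour {w} e with zigzag-neighbour e
    ... | inj₁ up = inj₂ (inj₁ (trans (sym up) (zigzagParent-x k<meet)))
    ... | inj₂ (x-child k'<meet _ x↑k≡y↑) = contradiction x↑k≡y↑ (x↑≢y↑ k<meet (<-≤-trans k'<meet meet≤D))
    ... | inj₂ (y-child k'<meet refl x↑k≡x↑k') =
            inj₂ (inj₂ (cong y↑ (x↑-injective (<meet⇒≤D k'<meet) (<meet⇒≤D k<meet) (sym x↑k≡x↑k'))))
    ... | inj₂ (off-child ¬on-x _ pw≡) =
            let uw , w≢pv = off-child-edge e pw≡ in inj₁ (uw , w≢pv , off≢lower k k<meet ¬on-x pw≡)

  degree-y : ∀ {k} → k < meet → degree zigzag (y↑ k) ≤ degree H (y↑ k)
  degree-y {zero} 0<meet = degree-exchange₁ zigzag H (parent-edge (y↑≢r 0<meet)) neighbour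
    where
    neighbour : ∀ {w} → Edge zigzag (y↑ 0) w → (Edge H (y↑ 0) w × w ≢ y↑ 1) ⊎ w ≡ x↑ 0
    neighbour e with zigzag-neighbour e
    ... | inj₁ up = inj₂ (trans (sym up) (zigzagParent-y 0<meet))
    ... | inj₂ (x-child k'<meet _ y↑0≡) =
            contradiction (y↑-injective z≤n (<-≤-trans k'<meet meet≤D) y↑0≡) (λ ())
    ... | inj₂ (y-child k'<meet _ y↑0≡) = contradiction y↑0≡ (y↑≢x↑ 0<meet (<meet⇒≤D k'<meet))
    ... | inj₂ (off-child _ _ pw≡)      = inj₁ (off-child-edge e pw≡)
  degree-y {suc k} k+1<meet =
    degree-exchange₂ zigzag H (parent-edge (y↑≢r k+1<meet)) (child-edge (≢parent (y↑≢r k<meet)) refl)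
      parent≢lower neighbour
    where
    k<meet : k < meet
    k<meet = <-trans (n<1+n k) k+1<meet

    parent≢lower : y↑ (suc (suc k)) ≢ y↑ k
    parent≢lower eq = m≢1+n+m k {1} (sym (y↑-injective (<-≤-trans k+1<meet meet≤D) (<meet⇒≤D k<meet) eq))

    neighbour : ∀ {w} → Edge zigzag (y↑ (suc k)) w →
      (Edge H (y↑ (suc k)) w × w ≢ y↑ (suc (suc k)) × w ≢ y↑ k) ⊎ w ≡ x↑ (suc k) ⊎ w ≡ x↑ k
    neighbour e with zigzag-neighbour e
    ... | inj₁ up = inj₂ (inj₁ (trans (sym up) (zigzagParent-y k+1<meet)))
    ... | inj₂ (x-child k'<meet refl y↑≡) =
            inj₂ (inj₂ (cong x↑ (suc-injective
              (y↑-injective (<-≤-trans k'<meet meet≤D) (<meet⇒≤D k+1<meet) (sym y↑≡)))))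
    ... | inj₂ (y-child k'<meet _ y↑≡)     = contradiction y↑≡ (y↑≢x↑ k+1<meet (<meet⇒≤D k'<meet))
    ... | inj₂ (off-child _ ¬on-y pw≡)     =
            let uw , w≢pv = off-child-edge e pw≡ in inj₁ (uw , w≢pv , λ w≡ → ¬on-y k<meet (sym w≡))

  degree-off : ∀ {v} → (∀ {k} → k < meet → x↑ k ≢ v) → (∀ {k} → k < meet → y↑ k ≢ v) →
    degree zigzag v ≤ degree H v
  degree-off {v} ¬on-x ¬on-y = degree-mono zigzag H neighbour
    where
    neighbour : ∀ {w} → Edge zigzag v w → Edge H v w
    neighbour {w} e with zigzag-neighbour e
    ... | inj₁ up =
            TreeEdge⇒Edge (proj₁ (parentGraph⁻ zigzagParent e) ,
                           inj₁ (trans (sym (zigzagParent-off ¬on-x ¬on-y)) up))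
    ... | inj₂ (x-child {k} k<meet refl v≡) = child-edge (proj₁ (parentGraph⁻ zigzagParent e) ∘ sym) (begin
            x↑ (suc k)   ≡⟨ cong x↑ k+1≡meet ⟩
            x↑ meet      ≡⟨ x↑meet≡y↑meet ⟩
            y↑ meet      ≡⟨ cong y↑ k+1≡meet ⟨
            y↑ (suc k)   ≡⟨ v≡ ⟨
            v            ∎)
      where
      open ≡-Reasoning
      -- v lies on neither chain, so y↑ (suc k) must already be the meeting point.
      k+1≡meet : suc k ≡ meet
      k+1≡meet = ≤-antisym k<meet (≮⇒≥ (λ k+1<meet → ¬on-y k+1<meet (sym v≡)))
    ... | inj₂ (y-child k<meet _ v≡)       = contradiction (sym v≡) (¬on-x k<meet)
    ... | inj₂ (off-child _ _ pw≡)         = proj₁ (off-child-edge e pw≡)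

  degree-zigzag-at : ∀ {v} → Position v → degree zigzag v ≤ degree H v
  degree-zigzag-at (on-x k<meet refl) = degree-x k<meet
  degree-zigzag-at (on-y k<meet refl) = degree-y k<meet
  degree-zigzag-at (off ¬on-x ¬on-y)  = degree-off ¬on-x ¬on-y

  zigzag-up : ∀ {u v} → u ≢ v → zigzagParent u ≡ v → Edge zigzag u v
  zigzag-up u≢v up = parentGraph⁺ zigzagParent (u≢v , inj₁ up)

  square-parent-at : ∀ {w} → Position w → w ≢ r → SqEdge zigzag w (parent w)
  square-parent-at (on-y {k} k<meet refl) w≢r = ≢parent w≢r , inj₂ (x↑ k ,
    zigzag-up (y↑≢x↑ k<meet (<meet⇒≤D k<meet)) (zigzagParent-y k<meet) ,
    zigzag-up (x↑≢y↑ k<meet (<-≤-trans k<meet meet≤D)) (zigzagParent-x k<meet))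
  square-parent-at (off ¬on-x ¬on-y) w≢r =
    ≢parent w≢r , inj₁ (zigzag-up (≢parent w≢r) (zigzagParent-off ¬on-x ¬on-y))
  square-parent-at (on-x {k} k<meet refl) w≢r = ≢parent w≢r , rungs (suc k <? meet)
    where
    rungs : Dec (suc k < meet) →
      Edge zigzag (x↑ k) (x↑ (suc k)) ⊎ ∃ λ t → Edge zigzag (x↑ k) t × Edge zigzag t (x↑ (suc k))
    rungs (yes k+1<meet) = inj₂ (y↑ (suc k) ,
      zigzag-up (x↑≢y↑ k<meet (<meet⇒≤D k+1<meet)) (zigzagParent-x k<meet) ,
      zigzag-up (y↑≢x↑ k+1<meet (<meet⇒≤D k+1<meet)) (zigzagParent-y k+1<meet))
    rungs (no k+1≮meet)  = inj₁ (zigzag-up (≢parent w≢r) (begin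
      zigzagParent (x↑ k) ≡⟨ zigzagParent-x k<meet ⟩
      y↑ (suc k)          ≡⟨ cong y↑ k+1≡meet ⟩
      y↑ meet             ≡⟨ x↑meet≡y↑meet ⟨
      x↑ meet             ≡⟨ cong x↑ k+1≡meet ⟨
      x↑ (suc k)          ∎))
      where
      open ≡-Reasoning
      k+1≡meet : suc k ≡ meet
      k+1≡meet = ≤-antisym k<meet (≮⇒≥ k+1≮meet)

  square-chord : SqEdge zigzag x y
  square-chord with n≤1⇒n≡0∨n≡1 c≤1
  ... | inj₁ c≡0 = x≢y , inj₁ (Edge-sym zigzag (zigzag-up (x≢y ∘ sym)
          (trans (cong zigzagParent (cong (λ t → ancestor t y) (sym c≡0))) (zigzagParent-y 1≤meet))))
    where
    x≢y : x ≢ y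
    x≢y = Edge⇒≢ H (proj₁ xy)
  ... | inj₂ c≡1 = x≢y , inj₂ (y↑ 0 ,
          Edge-sym zigzag (zigzag-up (x≢y↑0 ∘ sym) (zigzagParent-y 1≤meet)) ,
          Edge-sym zigzag (zigzag-up y≢y↑0 (trans (zigzagParent-off y-off-x y-off-y) parent-y≡y↑0)))
    where
    x≢y : x ≢ y
    x≢y = Edge⇒≢ H (proj₁ xy)
    D<depth-y : D < depth y
    D<depth-y = D<depth-ancestor-y {0} (≤-reflexive (sym c≡1))
    parent-y≡y↑0 : parent y ≡ y↑ 0
    parent-y≡y↑0 = cong (λ t → ancestor t y) (sym c≡1)
    y≢y↑0 : y ≢ y↑ 0
    y≢y↑0 eq = <⇒≢ D<depth-y (sym (trans (cong depth eq) depth-y↑0))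
    y-off-x : ∀ {k} → k < meet → x↑ k ≢ y
    y-off-x {k} _ eq = <⇒≱ D<depth-y (subst (_≤ D) (cong depth eq) (depth-x↑≤D k))
    y-off-y : ∀ {k} → k < meet → y↑ k ≢ y
    y-off-y {k} _ eq = <⇒≱ D<depth-y (subst (_≤ D) (cong depth eq) (depth-y↑≤D k))

  zigzag-square : (∀ {u v} → NonTreeEdge u v → (u ≡ x × v ≡ y) ⊎ (u ≡ y × v ≡ x)) →
    SubgraphOfSquare H zigzag
  zigzag-square only-chord u v uv with parent u ≟ v | parent v ≟ u
  ... | yes refl | _        = square-parent-at (position u) (≢parent⇒≢root (Edge⇒≢ H uv))
  ... | no _     | yes refl =
    SqEdge-sym zigzag (square-parent-at (position v) (≢parent⇒≢root (Edge⇒≢ H (Edge-sym H uv))))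
  ... | no pu≢v  | no pv≢u with only-chord (uv , pu≢v , pv≢u)
  ...   | inj₁ (refl , refl) = square-chord
  ...   | inj₂ (refl , refl) = SqEdge-sym zigzag square-chord

BoundedSquareRootTree : ∀ {n} → Graph n → Set
BoundedSquareRootTree {n} H = Σ (Graph n) (λ T → Tree T × Δ T ≤ Δ H × SubgraphOfSquare H T)

module SquareRootTree {n} {H : Graph n} {r : Fin n} (B : BFSTree H r) where
  open BFS B

  chord-on-cycle : ∀ {u v} → NonTreeEdge u v → Σ (Cycle H) λ C → CycleEdge C u v
  chord-on-cycle {u} {v} uv with depth u ≤? depth v
  ... | yes u≤v = Fundamental.cycle , Fundamental.closing∈cycle
    where open Chord B uv u≤v
  ... | no u≰v  = Fundamental.cycle , CycleEdge-sym Fundamental.cycle Fundamental.closing∈cycle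
    where open Chord B (NonTreeEdge-sym uv) (<⇒≤ (≰⇒> u≰v))

  -- uv lies on its own fundamental cycle, hence (by unicyclicity) on that of xy,
  -- whose only non-tree edge is xy.
  chord-unique : Unicyclic H → ∀ {x y} → NonTreeEdge x y → depth x ≤ depth y →
    ∀ {u v} → NonTreeEdge u v → (u ≡ x × v ≡ y) ⊎ (u ≡ y × v ≡ x)
  chord-unique unicyclic xy x≤y {u} {v} uv with chord-on-cycle uv
  ... | C , uv∈C with Fundamental.cycle-edges (unicyclic C Fundamental.cycle u v uv∈C)
    where open Chord B xy x≤y
  ...   | inj₁ tree-edge = contradiction tree-edge (NonTreeEdge⇒¬TreeEdge uv)
  ...   | inj₂ chord     = chord

  without-chord : (∀ u v → ¬ NonTreeEdge u v) → BoundedSquareRootTree H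
  without-chord no-chord = tree , tree-isTree , Δ-mono tree H degree≤ , square
    where
    degree≤ : ∀ u → degree tree u ≤ degree H u
    degree≤ u = degree-mono tree H (TreeEdge⇒Edge ∘ parentGraph⁻ parent)
    square : SubgraphOfSquare H tree
    square u v uv =
      Edge⇒≢ H uv , inj₁ (parentGraph⁺ parent (Edge⇒≢ H uv , treeLink (parent u ≟ v) (parent v ≟ u)))
      where
      treeLink : Dec (parent u ≡ v) → Dec (parent v ≡ u) → parent u ≡ v ⊎ parent v ≡ u
      treeLink (yes pu≡v) _          = inj₁ pu≡v
      treeLink (no _)     (yes pv≡u) = inj₂ pv≡u
      treeLink (no pu≢v)  (no pv≢u)  = contradiction (uv , pu≢v , pv≢u) (no-chord u v)

  with-chord : Unicyclic H → ∀ {x y} → NonTreeEdge x y → depth x ≤ depth y → BoundedSquareRootTree H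
  with-chord unicyclic xy x≤y =
    zigzag , zigzag-isTree , Δ-mono zigzag H (degree-zigzag-at ∘ position) ,
    zigzag-square (chord-unique unicyclic xy x≤y)
    where open Zigzag B xy x≤y

  boundedSquareRootTree : Unicyclic H → BoundedSquareRootTree H
  boundedSquareRootTree unicyclic with any? (λ u → any? (λ v → nonTreeEdge? u v))
  ... | no ∄chord = without-chord (λ u v uv → ∄chord (u , v , uv))
  ... | yes (u , v , uv) with depth u ≤? depth v
  ...   | yes u≤v = with-chord unicyclic uv u≤v
  ...   | no u≰v  = with-chord unicyclic (NonTreeEdge-sym uv) (<⇒≤ (≰⇒> u≰v))

lemma5p3 : ∀ (n : ℕ) (H : Graph n) → Connected H → Unicyclic H →
    Σ (Graph n) (λ T → Tree T × Δ T ≤ Δ H × SubgraphOfSquare H T)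
lemma5p3 zero    H connected _ = H , (connected , λ C → case vert C zero of λ ()) , ≤-refl , λ ()
lemma5p3 (suc m) H connected unicyclic =
  SquareRootTree.boundedSquareRootTree (bfsTree H zero connected) unicyclic
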